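{- Let $\widehat{G}$ be a minimum interval supergraph of a graph $G$, and let $G'$ be any graph with $V(G')=V(G)$ and $E(G)\subseteq E(G')\subseteq E(\widehat{G})$. Then every module $M$ of $G'$ such that $G'[M]$ is connected is a module of $\widehat{G}$.
   Context: Graphs are finite, simple, undirected. A module of a graph $\Gamma$ is a set $M\subseteq V(\Gamma)$ such that every vertex outside $M$ is adjacent to all or none of $M$. An interval supergraph of $G$ is an interval graph on vertex set $V(G)$ whose edge set contains $E(G)$; it is minimum if it has the minimum number of edges among such. -}

module Defs where

open import Data.Nat using (ℕ; _≤_)
open import Data.Bool using (Bool; true; false; _∧_; if_then_else_)
open import Data.Fin using (Fin; _<?_)
open import Data.List using (List; []; _∷_; map; allFin)
open import Data.Nat.ListAction using (sum)
open import Data.Product using (Σ; _×_; ∃₂)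
open import Data.Sum using (_⊎_)
open import Relation.Nullary using (¬_; does)
open import Relation.Binary.PropositionalEquality using (_≡_; _≢_)
open import Function.Bundles using (_⇔_)

record Graph (n : ℕ) : Set where
  field
    adj    : Fin n → Fin n → Bool
    sym    : ∀ u v → adj u v ≡ adj v u
    irrefl : ∀ v → adj v v ≡ false
open Graph public

_—_∈_ : ∀ {n} → Fin n → Fin n → Graph n → Set
u — v ∈ G = adj G u v ≡ true

_⊆E_ : ∀ {n} → Graph n → Graph n → Set
G ⊆E H = ∀ u v → u — v ∈ G → u — v ∈ H

edgeCount : ∀ {n} → Graph n → ℕ
edgeCount {n} G =
  sum (map (λ i → sum (map (λ j → if does (i <? j) ∧ adj G i j then 1 else 0)
                           (allFin n)))
           (allFin n))

-- Interval graph: each vertex v gets a closed interval [l v , r v]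
-- (integer endpoints suffice for finite graphs), and distinct vertices
-- are adjacent iff their intervals intersect.
IsInterval : ∀ {n} → Graph n → Set
IsInterval {n} G =
  ∃₂ λ (l r : Fin n → ℕ) →
    (∀ v → l v ≤ r v) ×
    (∀ u v → u ≢ v → (u — v ∈ G ⇔ (l u ≤ r v × l v ≤ r u)))

IsIntervalSupergraph : ∀ {n} → Graph n → Graph n → Set
IsIntervalSupergraph G H = IsInterval H × (G ⊆E H)

IsMinimumIntervalSupergraph : ∀ {n} → Graph n → Graph n → Set
IsMinimumIntervalSupergraph {n} G H =
  IsIntervalSupergraph G H ×
  (∀ (H' : Graph n) → IsIntervalSupergraph G H' → edgeCount H ≤ edgeCount H')

VSet : ℕ → Set
VSet n = Fin n → Bool

_∈V_ : ∀ {n} → Fin n → VSet n → Set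
v ∈V M = M v ≡ true

IsModule : ∀ {n} → Graph n → VSet n → Set
IsModule G M =
  ∀ v → ¬ (v ∈V M) →
    (∀ u → u ∈V M → v — u ∈ G) ⊎ (∀ u → u ∈V M → ¬ (v — u ∈ G))

data WalkIn {n} (G : Graph n) (M : VSet n) : Fin n → Fin n → Set where
  here : ∀ {u} → u ∈V M → WalkIn G M u u
  step : ∀ {u v w} → u ∈V M → u — v ∈ G → WalkIn G M v w → WalkIn G M u w

InducedConnected : ∀ {n} → Graph n → VSet n → Set
InducedConnected G M =
  (Σ _ λ v → v ∈V M) × (∀ u w → u ∈V M → w ∈V M → WalkIn G M u w)

module Submission where

-- Suppose some v ∉ M is Ĝ-adjacent to part of M only. A walk in G′[M] then contains an edge uu′ with
-- v ~ u and v ≁ u′ in Ĝ. Fix an interval model of Ĝ. The vertices outside M with a G-neighbour in M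
-- ("attached" vertices) are complete to M in G′ ⊆ Ĝ, so their intervals meet every interval of M.
-- Pick a window [t₁, t₂] meeting all attached intervals: a stabbing point that lies in as few
-- intervals of vertices outside M as possible or, if no point stabs them all, the gap between the
-- least right end and the greatest left end of the attached intervals, which every interval of M
-- then contains. Replacing the Ĝ-edges between M and its complement by edges from M to the outside
-- vertices whose intervals meet the window yields an interval supergraph of G (squeeze the
-- intervals of M into the window). No vertex of M ends up with more neighbours outside M than in Ĝ
-- (for a point window by minimality: the point can be moved into the interval of any vertex of M),
-- and u strictly fewer, as v misses the window; so this supergraph has fewer edges than Ĝ.

open import Data.Bool using (Bool; true; false; _∧_; if_then_else_)
import Data.Bool.Properties as Bool
open import Data.Bool.Properties using (¬-not; not-¬)
open import Data.Empty using (⊥-elim)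
open import Data.Fin using (Fin; zero; suc; _<?_) renaming (_<_ to _<ᶠ_)
import Data.Fin.Properties as Fin
open import Data.List using (List; map; allFin; tabulate; filter; upTo)
open import Data.List.Extrema.Nat
  using (argmin; argmin-all; f[argmin]≤f[xs]; min; min≤xs; v≤min⁺; max; xs≤max; max≤v⁺)
open import Data.List.Membership.Propositional.Properties using (∈-map⁺; ∈-allFin; ∈-filter⁺; ∈-upTo⁺)
open import Data.List.Properties using (map-tabulate)
import Data.List.Relation.Unary.All as All
open import Data.List.Relation.Unary.All using (All)
open import Data.List.Relation.Unary.All.Properties using (all-filter; map⁺)
open import Data.Nat using (ℕ; zero; suc; _+_; _*_; _⊔_; _⊓_; _≤_; _<_; _≤?_; z≤n; s≤s)
import Data.Nat.ListAction as List
open import Data.Nat.Properties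
  using ( ≤-refl; ≤-reflexive; ≤-trans; <-irrefl; <-≤-trans; ≤-<-trans; <⇒≤; ≮⇒≥; ≰⇒>; <⇒≱
        ; m≤n⇒m<n∨m≡n; n<1+n; m≤m+n; module ≤-Reasoning
        ; +-comm; +-identityʳ; +-assoc; +-mono-≤; +-monoʳ-≤; +-mono-<-≤; +-mono-≤-<; +-monoʳ-<; +-cancelˡ-≤
        ; *-suc; *-monoʳ-≤; ⊓-glb; ⊔-lub; m≤n⊔m; m≤m⊔n; m⊓n≤m; m⊓n≤n; +-0-commutativeMonoid)
open import Algebra.Properties.CommutativeMonoid.Sum +-0-commutativeMonoid
  using (sum-syntax; sum-cong-≗; sum-replicate-zero; ∑-distrib-+; ∑-comm)
open import Data.Product using (Σ; _×_; _,_; ∃; proj₁; proj₂; swap)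
open import Data.Product.Function.NonDependent.Propositional using (_×-⇔_)
open import Data.Sum using (inj₁; inj₂)
open import Function using (id; _∘_; _⇔_; mk⇔; Equivalence)
import Function.Properties.Equivalence as ⇔
open import Relation.Binary.Definitions using (tri<; tri≈; tri>)
open import Relation.Binary.PropositionalEquality
open import Relation.Nullary using (¬_; ¬?; Dec; does; yes; no; _×-dec_; _→-dec_)
open import Relation.Nullary.Decidable using (dec-true; dec-false)
open import Relation.Unary using (Decidable)

open import Defs hiding (sym)

indicator : Bool → ℕ
indicator b = if b then 1 else 0

list-sum-tabulate : ∀ {n} (f : Fin n → ℕ) → List.sum (tabulate f) ≡ ∑[ i < n ] f i
list-sum-tabulate {zero}  f = refl
list-sum-tabulate {suc n} f = cong (f zero +_) (list-sum-tabulate (f ∘ suc))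

list-sum-allFin : ∀ {n} (f : Fin n → ℕ) → List.sum (map f (allFin n)) ≡ ∑[ i < n ] f i
list-sum-allFin f = trans (cong List.sum (map-tabulate id f)) (list-sum-tabulate f)

∑-mono-≤ : ∀ {n} {f g : Fin n → ℕ} → (∀ i → f i ≤ g i) → ∑[ i < n ] f i ≤ ∑[ i < n ] g i
∑-mono-≤ {zero}  f≤g = z≤n
∑-mono-≤ {suc n} f≤g = +-mono-≤ (f≤g zero) (∑-mono-≤ (f≤g ∘ suc))

∑-mono-< : ∀ {n} {f g : Fin n → ℕ} → (∀ i → f i ≤ g i) →
           ∀ i₀ → f i₀ < g i₀ → ∑[ i < n ] f i < ∑[ i < n ] g i
∑-mono-< f≤g zero    f<g = +-mono-<-≤ f<g (∑-mono-≤ (f≤g ∘ suc))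
∑-mono-< f≤g (suc i) f<g = +-mono-≤-< (f≤g zero) (∑-mono-< (f≤g ∘ suc) i f<g)

isEdge : ∀ {n} → Graph n → Fin n → Fin n → ℕ
isEdge X i j = indicator (does (i <? j) ∧ adj X i j)

isEdge-< : ∀ {n} (X : Graph n) {i j} → i <ᶠ j → isEdge X i j ≡ indicator (adj X i j)
isEdge-< X {i} {j} i<j = cong (λ b → indicator (b ∧ adj X i j)) (dec-true (i <? j) i<j)

isEdge-≮ : ∀ {n} (X : Graph n) {i j} → ¬ i <ᶠ j → isEdge X i j ≡ 0
isEdge-≮ X {i} {j} i≮j = cong (λ b → indicator (b ∧ adj X i j)) (dec-false (i <? j) i≮j)

isEdge-pair : ∀ {n} (X : Graph n) {i j} → i ≢ j → isEdge X i j + isEdge X j i ≡ indicator (adj X i j)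
isEdge-pair X {i} {j} i≢j with Fin.<-cmp i j
... | tri< i<j _ j≮i = trans (cong₂ _+_ (isEdge-< X i<j) (isEdge-≮ X j≮i)) (+-identityʳ _)
... | tri≈ _ i≡j _   = ⊥-elim (i≢j i≡j)
... | tri> i≮j _ j<i = trans (cong₂ _+_ (isEdge-≮ X i≮j) (isEdge-< X j<i)) (cong indicator (Graph.sym X j i))

∑∑ : ∀ {n} → (Fin n → Fin n → ℕ) → ℕ
∑∑ {n} f = ∑[ i < n ] ∑[ j < n ] f i j

∑∑-cong : ∀ {n} {f g : Fin n → Fin n → ℕ} → (∀ i j → f i j ≡ g i j) → ∑∑ f ≡ ∑∑ g
∑∑-cong f≡g = sum-cong-≗ (λ i → sum-cong-≗ (f≡g i))

∑∑-distrib-+ : ∀ {n} (f g : Fin n → Fin n → ℕ) → ∑∑ (λ i j → f i j + g i j) ≡ ∑∑ f + ∑∑ g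
∑∑-distrib-+ {n} f g = trans (sum-cong-≗ (λ i → ∑-distrib-+ (f i) (g i)))
                             (∑-distrib-+ (λ i → ∑[ j < n ] f i j) (λ i → ∑[ j < n ] g i j))

edgeCount≡∑∑isEdge : ∀ {n} (X : Graph n) → edgeCount X ≡ ∑∑ (isEdge X)
edgeCount≡∑∑isEdge {n} X =
  trans (list-sum-allFin (λ i → List.sum (map (isEdge X i) (allFin n))))
        (sum-cong-≗ (λ i → list-sum-allFin (isEdge X i)))

sameSide : Bool → Bool → ℕ → ℕ
sameSide true  true  x = x
sameSide false false x = x
sameSide _     _     _ = 0

crossing : Bool → Bool → ℕ → ℕ
crossing true false x = x
crossing _    _     _ = 0

split-by-sides : ∀ b c x → x ≡ sameSide b c x + crossing b c x + crossing c b x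
split-by-sides true  true  x = sym (trans (+-identityʳ _) (+-identityʳ x))
split-by-sides true  false x = sym (+-identityʳ x)
split-by-sides false true  x = refl
split-by-sides false false x = sym (trans (+-identityʳ _) (+-identityʳ x))

sameSide-cong : ∀ b c {x y} → (b ≡ c → x ≡ y) → sameSide b c x ≡ sameSide b c y
sameSide-cong true  true  x≡y = x≡y refl
sameSide-cong true  false x≡y = refl
sameSide-cong false true  x≡y = refl
sameSide-cong false false x≡y = x≡y refl

crossing-+ : ∀ b c {x y z} → (b ≡ true → c ≡ false → x + y ≡ z) →
             crossing b c x + crossing b c y ≡ crossing b c z
crossing-+ true  true  _   = refl
crossing-+ true  false x+y = x+y refl refl
crossing-+ false _     _   = refl

crossing-outside-≤ : ∀ c {b b′} → (c ≡ false → b ≡ true → b′ ≡ true) →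
                     crossing true c (indicator b) ≤ crossing true c (indicator b′)
crossing-outside-≤ true          _   = z≤n
crossing-outside-≤ false {false} _   = z≤n
crossing-outside-≤ false {true}  b⇒b′ rewrite b⇒b′ refl refl = ≤-refl

crossing-outside-< : ∀ {c b b′} → c ≡ false → b ≡ false → b′ ≡ true →
                     crossing true c (indicator b) < crossing true c (indicator b′)
crossing-outside-< refl refl refl = s≤s z≤n

inside≢outside : ∀ {n} {M : VSet n} {i j} → i ∈V M → M j ≡ false → i ≢ j
inside≢outside i∈M j∉M refl with () ← trans (sym i∈M) j∉M

module _ {n} (M : VSet n) where

  sameSideCount : Graph n → ℕ
  sameSideCount X = ∑∑ λ i j → sameSide (M i) (M j) (isEdge X i j)

  cutDegree : Graph n → Fin n → ℕ
  cutDegree X i = ∑[ j < n ] crossing (M i) (M j) (indicator (adj X i j))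

  edgeCount-split : ∀ X → edgeCount X ≡ sameSideCount X + ∑[ i < n ] cutDegree X i
  edgeCount-split X = begin
    edgeCount X
      ≡⟨ edgeCount≡∑∑isEdge X ⟩
    ∑∑ e
      ≡⟨ ∑∑-cong (λ i j → split-by-sides (M i) (M j) (e i j)) ⟩
    ∑∑ (λ i j → S i j + C i j (e i j) + C j i (e i j))
      ≡⟨ trans (∑∑-distrib-+ _ (λ i j → C j i (e i j)))
                (cong (_+ ∑∑ (λ i j → C j i (e i j))) (∑∑-distrib-+ S (λ i j → C i j (e i j)))) ⟩
    ∑∑ S + ∑∑ (λ i j → C i j (e i j)) + ∑∑ (λ i j → C j i (e i j))
      ≡⟨ cong (∑∑ S + ∑∑ (λ i j → C i j (e i j)) +_) (∑-comm (λ i j → C j i (e i j))) ⟩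
    ∑∑ S + ∑∑ (λ i j → C i j (e i j)) + ∑∑ (λ i j → C i j (e j i))
      ≡⟨ +-assoc (∑∑ S) _ _ ⟩
    ∑∑ S + (∑∑ (λ i j → C i j (e i j)) + ∑∑ (λ i j → C i j (e j i)))
      ≡⟨ cong (∑∑ S +_) (sym (∑∑-distrib-+ (λ i j → C i j (e i j)) (λ i j → C i j (e j i)))) ⟩
    ∑∑ S + ∑∑ (λ i j → C i j (e i j) + C i j (e j i))
      ≡⟨ cong (∑∑ S +_) (∑∑-cong λ i j → crossing-+ (M i) (M j) λ Mi Mj →
                                            isEdge-pair X (inside≢outside Mi Mj)) ⟩
    ∑∑ S + ∑∑ (λ i j → C i j (indicator (adj X i j))) ∎
    where
    open ≡-Reasoning
    e : Fin n → Fin n → ℕ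
    e = isEdge X
    S : Fin n → Fin n → ℕ
    S i j = sameSide (M i) (M j) (e i j)
    C : Fin n → Fin n → ℕ → ℕ
    C i j = crossing (M i) (M j)

  cutDegree-outside : ∀ X {i} → M i ≡ false → cutDegree X i ≡ 0
  cutDegree-outside X {i} i∉M =
    trans (sum-cong-≗ (λ j → cong (λ b → crossing b (M j) (indicator (adj X i j))) i∉M))
          (sum-replicate-zero n)

  edgeCount-<-by-cutDegree : ∀ X Y → (∀ i j → M i ≡ M j → adj X i j ≡ adj Y i j) →
    (∀ i → i ∈V M → cutDegree X i ≤ cutDegree Y i) →
    ∀ {i₀} → i₀ ∈V M → cutDegree X i₀ < cutDegree Y i₀ → edgeCount X < edgeCount Y
  edgeCount-<-by-cutDegree X Y agree cut≤ {i₀} _ cut< = begin-strict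
    edgeCount X                                    ≡⟨ edgeCount-split X ⟩
    sameSideCount X + ∑[ i < n ] cutDegree X i     ≡⟨ cong (_+ ∑[ i < n ] cutDegree X i) sameSides ⟩
    sameSideCount Y + ∑[ i < n ] cutDegree X i     <⟨ +-monoʳ-< (sameSideCount Y) (∑-mono-< cut≤′ i₀ cut<) ⟩
    sameSideCount Y + ∑[ i < n ] cutDegree Y i     ≡⟨ edgeCount-split Y ⟨
    edgeCount Y                                    ∎
    where
    open ≤-Reasoning
    sameSides : sameSideCount X ≡ sameSideCount Y
    sameSides = ∑∑-cong λ i j → sameSide-cong (M i) (M j) λ Mi≡Mj →
      cong (λ b → indicator (does (i <? j) ∧ b)) (agree i j Mi≡Mj)
    cut≤′ : ∀ i → cutDegree X i ≤ cutDegree Y i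
    cut≤′ i with M i Bool.≟ true
    ... | yes i∈M = cut≤ i i∈M
    ... | no  i∉M = ≤-reflexive (trans (cutDegree-outside X (¬-not i∉M))
                                       (sym (cutDegree-outside Y (¬-not i∉M))))

module Blocks (B : ℕ) where

  at : ℕ → ℕ → ℕ
  at a c = suc B * a + c

  start end : ℕ → ℕ
  start a = at a 0
  end   a = at a B

  at-mono : ∀ {a b c d} → a ≤ b → c ≤ d → at a c ≤ at b d
  at-mono a≤b c≤d = +-mono-≤ (*-monoʳ-≤ (suc B) a≤b) c≤d

  at-< : ∀ {a b c d} → a < b → c ≤ B → at a c < at b d
  at-< {a} {b} {c} {d} a<b c≤B = begin-strict
    suc B * a + c          ≤⟨ +-monoʳ-≤ (suc B * a) c≤B ⟩
    suc B * a + B          <⟨ +-monoʳ-< (suc B * a) (n<1+n B) ⟩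
    suc B * a + suc B      ≡⟨ +-comm (suc B * a) (suc B) ⟩
    suc B + suc B * a      ≡⟨ *-suc (suc B) a ⟨
    suc B * suc a          ≤⟨ *-monoʳ-≤ (suc B) a<b ⟩
    suc B * b              ≤⟨ m≤m+n (suc B * b) d ⟩
    suc B * b + d          ∎
    where open ≤-Reasoning

  at-≤⇒≤ : ∀ {a b c d} → d ≤ B → at a c ≤ at b d → a ≤ b
  at-≤⇒≤ d≤B ac≤bd = ≮⇒≥ λ b<a → <⇒≱ (at-< b<a d≤B) ac≤bd

  at-≤-end⇔ : ∀ {a b c} → c ≤ B → (at a c ≤ end b ⇔ a ≤ b)
  at-≤-end⇔ c≤B = mk⇔ (at-≤⇒≤ ≤-refl) (λ a≤b → at-mono a≤b c≤B)

  start-≤-at⇔ : ∀ {a b d} → d ≤ B → (start a ≤ at b d ⇔ a ≤ b)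
  start-≤-at⇔ d≤B = mk⇔ (at-≤⇒≤ d≤B) (λ a≤b → at-mono a≤b z≤n)

  at-≤-at⇔ : ∀ {a c d} → (at a c ≤ at a d ⇔ c ≤ d)
  at-≤-at⇔ {a} = mk⇔ (+-cancelˡ-≤ (suc B * a) _ _) (+-monoʳ-≤ (suc B * a))

does-∧⇔ : ∀ {A C : Set} (a? : Dec A) (c? : Dec C) → (does a? ∧ does c? ≡ true ⇔ (A × C))
does-∧⇔ (yes a) (yes c) = mk⇔ (λ _ → a , c) (λ _ → refl)
does-∧⇔ (yes _) (no ¬c) = mk⇔ (λ ()) (λ (_ , c) → ⊥-elim (¬c c))
does-∧⇔ (no ¬a) _       = mk⇔ (λ ()) (λ (a , _) → ⊥-elim (¬a a))

Attached : ∀ {n} → Graph n → VSet n → Fin n → Set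
Attached G M x = ¬ x ∈V M × ∃ λ m → m ∈V M × x — m ∈ G

attached? : ∀ {n} (G : Graph n) (M : VSet n) → Decidable (Attached G M)
attached? G M x = ¬? (M x Bool.≟ true) ×-dec Fin.any? λ m → (M m Bool.≟ true) ×-dec (adj G x m Bool.≟ true)

SmallerIntervalSupergraph : ∀ {n} → Graph n → Graph n → Set
SmallerIntervalSupergraph {n} G Ĝ = Σ (Graph n) λ H → IsIntervalSupergraph G H × edgeCount H < edgeCount Ĝ

minimum⇒¬smaller : ∀ {n} {G Ĝ : Graph n} → IsMinimumIntervalSupergraph G Ĝ → ¬ SmallerIntervalSupergraph G Ĝ
minimum⇒¬smaller (_ , minimum) (H , H-supergraph , fewer) = <⇒≱ fewer (minimum H H-supergraph)

clamp : ℕ → ℕ → ℕ → ℕ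
clamp a b p = a ⊔ (p ⊓ b)

clamp-between : ∀ {a b} p → a ≤ b → a ≤ clamp a b p × clamp a b p ≤ b
clamp-between {a} {b} p a≤b = m≤m⊔n a (p ⊓ b) , ⊔-lub a≤b (m⊓n≤n p b)

clamp-stays-within : ∀ {a b x y} p → x ≤ b → a ≤ y → x ≤ p → p ≤ y → x ≤ clamp a b p × clamp a b p ≤ y
clamp-stays-within {a} {b} p x≤b a≤y x≤p p≤y =
  ≤-trans (⊓-glb x≤p x≤b) (m≤n⊔m a (p ⊓ b)) , ⊔-lub a≤y (≤-trans (m⊓n≤m p b) p≤y)

module IntervalModel {n} (Ĝ : Graph n) (l r : Fin n → ℕ) (l≤r : ∀ v → l v ≤ r v)
  (model : ∀ u v → u ≢ v → (u — v ∈ Ĝ ⇔ (l u ≤ r v × l v ≤ r u))) where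

  B : ℕ
  B = max 0 (map r (allFin n))

  r≤B : ∀ v → r v ≤ B
  r≤B v = All.lookup (xs≤max 0 (map r (allFin n))) (∈-map⁺ r (∈-allFin v))

  l≤B : ∀ v → l v ≤ B
  l≤B v = ≤-trans (l≤r v) (r≤B v)

  open Blocks B

  overlap⇒adjacent : ∀ {u v} → u ≢ v → l u ≤ r v → l v ≤ r u → u — v ∈ Ĝ
  overlap⇒adjacent {u} {v} u≢v lu≤rv lv≤ru = Equivalence.from (model u v u≢v) (lu≤rv , lv≤ru)

  adjacent⇒overlap : ∀ {u v} → u ≢ v → u — v ∈ Ĝ → l u ≤ r v × l v ≤ r u
  adjacent⇒overlap {u} {v} u≢v = Equivalence.to (model u v u≢v)

  Covers : Fin n → ℕ → ℕ → Set
  Covers m t₁ t₂ = l m ≤ t₁ × t₂ ≤ r m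

  meets : ℕ → ℕ → Fin n → Bool
  meets t₁ t₂ x = does (l x ≤? t₂) ∧ does (t₁ ≤? r x)

  meets⇔ : ∀ {t₁ t₂ x} → (meets t₁ t₂ x ≡ true ⇔ (l x ≤ t₂ × t₁ ≤ r x))
  meets⇔ {t₁} {t₂} {x} = does-∧⇔ (l x ≤? t₂) (t₁ ≤? r x)

  covers-meets⇒adjacent : ∀ {m x t₁ t₂} → Covers m t₁ t₂ → m ≢ x → meets t₁ t₂ x ≡ true → m — x ∈ Ĝ
  covers-meets⇒adjacent (lm≤t₁ , t₂≤rm) m≢x meet =
    let lx≤t₂ , t₁≤rx = Equivalence.to meets⇔ meet in
    overlap⇒adjacent m≢x (≤-trans lm≤t₁ t₁≤rx) (≤-trans lx≤t₂ t₂≤rm)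

  module _ (M : VSet n) where

    windowCount : ℕ → ℕ → ℕ
    windowCount t₁ t₂ = ∑[ j < n ] crossing true (M j) (indicator (meets t₁ t₂ j))

    cutDegree-inside : ∀ X {i} → i ∈V M →
      cutDegree M X i ≡ ∑[ j < n ] crossing true (M j) (indicator (adj X i j))
    cutDegree-inside X {i} i∈M =
      sum-cong-≗ (λ j → cong (λ b → crossing b (M j) (indicator (adj X i j))) i∈M)

    private
      windowCount≤cutDegree-pointwise : ∀ {m t₁ t₂} → m ∈V M → Covers m t₁ t₂ → ∀ j →
        crossing true (M j) (indicator (meets t₁ t₂ j)) ≤ crossing true (M j) (indicator (adj Ĝ m j))
      windowCount≤cutDegree-pointwise m∈M covers j =
        crossing-outside-≤ (M j) λ j∉M → covers-meets⇒adjacent covers (inside≢outside m∈M j∉M)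

    windowCount-≤-cutDegree : ∀ {m t₁ t₂} → m ∈V M → Covers m t₁ t₂ → windowCount t₁ t₂ ≤ cutDegree M Ĝ m
    windowCount-≤-cutDegree m∈M covers =
      ≤-trans (∑-mono-≤ (windowCount≤cutDegree-pointwise m∈M covers)) (≤-reflexive (sym (cutDegree-inside Ĝ m∈M)))

    windowCount-<-cutDegree : ∀ {m v t₁ t₂} → m ∈V M → Covers m t₁ t₂ →
      ¬ v ∈V M → m — v ∈ Ĝ → meets t₁ t₂ v ≡ false → windowCount t₁ t₂ < cutDegree M Ĝ m
    windowCount-<-cutDegree {v = v} m∈M covers v∉M m—v v-misses =
      <-≤-trans (∑-mono-< (windowCount≤cutDegree-pointwise m∈M covers) v
                          (crossing-outside-< (¬-not v∉M) v-misses m—v))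
                (≤-reflexive (sym (cutDegree-inside Ĝ m∈M)))

    module _ (t₁ t₂ : ℕ) where

      adjBySide : Bool → Bool → Fin n → Fin n → Bool
      adjBySide true  false u v = meets t₁ t₂ v
      adjBySide false true  u v = meets t₁ t₂ u
      adjBySide _     _     u v = adj Ĝ u v

      rewired : Graph n
      rewired = record
        { adj    = λ u v → adjBySide (M u) (M v) u v
        ; sym    = λ u v → adjBySide-sym (M u) (M v)
        ; irrefl = λ v → adjBySide-irrefl (M v)
        }
        where
        adjBySide-sym : ∀ b c {u v} → adjBySide b c u v ≡ adjBySide c b v u
        adjBySide-sym true  true  = Graph.sym Ĝ _ _
        adjBySide-sym true  false = refl
        adjBySide-sym false true  = refl
        adjBySide-sym false false = Graph.sym Ĝ _ _

        adjBySide-irrefl : ∀ b {v} → adjBySide b b v v ≡ false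
        adjBySide-irrefl true  = Graph.irrefl Ĝ _
        adjBySide-irrefl false = Graph.irrefl Ĝ _

      rewired-sameSide : ∀ i j → M i ≡ M j → adj rewired i j ≡ adj Ĝ i j
      rewired-sameSide i j Mi≡Mj = subst (λ c → adjBySide (M i) c i j ≡ adj Ĝ i j) Mi≡Mj (same (M i))
        where
        same : ∀ b → adjBySide b b i j ≡ adj Ĝ i j
        same true  = refl
        same false = refl

      cutDegree-rewired : ∀ {m} → m ∈V M → cutDegree M rewired m ≡ windowCount t₁ t₂
      cutDegree-rewired {m} m∈M = trans (cutDegree-inside rewired m∈M) (sum-cong-≗ λ j → toWindow (M j))
        where
        toWindow : ∀ c {j} → crossing true c (indicator (adjBySide (M m) c m j))
                           ≡ crossing true c (indicator (meets t₁ t₂ j))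
        toWindow true  = refl
        toWindow false = cong (λ b → indicator (adjBySide b false m _)) m∈M

      -- The line is cut into blocks of B + 1 points. An outside vertex v occupies the whole blocks
      -- l v … r v; a vertex v of M occupies blocks t₁ … t₂, from offset l v to offset r v.
      leftBySide rightBySide : Bool → Fin n → ℕ
      leftBySide  true  v = at t₁ (l v)
      leftBySide  false v = start (l v)
      rightBySide true  v = at t₂ (r v)
      rightBySide false v = end (r v)

      rewired-isInterval : t₁ ≤ t₂ → (t₁ < t₂ → ∀ m → m ∈V M → Covers m t₁ t₂) → IsInterval rewired
      rewired-isInterval t₁≤t₂ covers =
          (λ v → leftBySide (M v) v) , (λ v → rightBySide (M v) v)
        , (λ v → ordered (M v))
        , λ u v u≢v → represents (M u) (M v) refl refl u≢v
        where
        ordered : ∀ b {v} → leftBySide b v ≤ rightBySide b v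
        ordered true  = at-mono t₁≤t₂ (l≤r _)
        ordered false = at-mono (l≤r _) z≤n

        represents : ∀ b c {u v} → M u ≡ b → M v ≡ c → u ≢ v →
          (adjBySide b c u v ≡ true ⇔ (leftBySide b u ≤ rightBySide c v × leftBySide c v ≤ rightBySide b u))
        represents true true {u} {v} u∈M v∈M u≢v with m≤n⇒m<n∨m≡n t₁≤t₂
        ... | inj₁ t₁<t₂ =
          let lu≤t₁ , t₂≤ru = covers t₁<t₂ u u∈M
              lv≤t₁ , t₂≤rv = covers t₁<t₂ v v∈M in
          mk⇔ (λ _ → <⇒≤ (at-< t₁<t₂ (l≤B u)) , <⇒≤ (at-< t₁<t₂ (l≤B v)))
              (λ _ → overlap⇒adjacent u≢v (≤-trans lu≤t₁ (≤-trans t₁≤t₂ t₂≤rv))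
                                          (≤-trans lv≤t₁ (≤-trans t₁≤t₂ t₂≤ru)))
        ... | inj₂ refl = ⇔.trans (model u v u≢v) (⇔.sym (at-≤-at⇔ {t₁} ×-⇔ at-≤-at⇔ {t₁}))
        represents true false {u} {v} _ _ u≢v =
          ⇔.trans meets⇔ (⇔.trans (mk⇔ swap swap) (⇔.sym (at-≤-end⇔ (l≤B u) ×-⇔ start-≤-at⇔ (r≤B u))))
        represents false true {u} {v} _ _ u≢v =
          ⇔.trans meets⇔ (⇔.sym (start-≤-at⇔ (r≤B v) ×-⇔ at-≤-end⇔ (l≤B v)))
        represents false false {u} {v} _ _ u≢v =
          ⇔.trans (model u v u≢v) (⇔.sym (start-≤-at⇔ ≤-refl ×-⇔ start-≤-at⇔ ≤-refl))

      rewired-⊇ : (G : Graph n) → G ⊆E Ĝ → (∀ x → Attached G M x → meets t₁ t₂ x ≡ true) → G ⊆E rewired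
      rewired-⊇ G G⊆Ĝ attached-meets u v u—v = bySide (M u) (M v) refl refl
        where
        bySide : ∀ b c → M u ≡ b → M v ≡ c → adjBySide b c u v ≡ true
        bySide true  true  _   _   = G⊆Ĝ u v u—v
        bySide false false _   _   = G⊆Ĝ u v u—v
        bySide true  false u∈M v∉M = attached-meets v (not-¬ v∉M , u , u∈M , trans (Graph.sym G v u) u—v)
        bySide false true  u∉M v∈M = attached-meets u (not-¬ u∉M , v , v∈M , u—v)

    module _ (G : Graph n) (G⊆Ĝ : G ⊆E Ĝ) where

      window⇒smaller : ∀ {t₁ t₂} → t₁ ≤ t₂ → (t₁ < t₂ → ∀ m → m ∈V M → Covers m t₁ t₂) →
        (∀ x → Attached G M x → l x ≤ t₂ × t₁ ≤ r x) →
        (∀ m → m ∈V M → windowCount t₁ t₂ ≤ cutDegree M Ĝ m) →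
        ∀ {u} → u ∈V M → windowCount t₁ t₂ < cutDegree M Ĝ u → SmallerIntervalSupergraph G Ĝ
      window⇒smaller {t₁} {t₂} t₁≤t₂ covers attached-meets window≤ u∈M window< =
          rewired t₁ t₂
        , ( rewired-isInterval t₁ t₂ t₁≤t₂ covers
          , rewired-⊇ t₁ t₂ G G⊆Ĝ λ x attached → Equivalence.from meets⇔ (attached-meets x attached))
        , edgeCount-<-by-cutDegree M (rewired t₁ t₂) Ĝ (rewired-sameSide t₁ t₂)
            (λ m m∈M → ≤-trans (≤-reflexive (cutDegree-rewired t₁ t₂ m∈M)) (window≤ m m∈M))
            u∈M (≤-<-trans (≤-reflexive (cutDegree-rewired t₁ t₂ u∈M)) window<)

      Stabs : ℕ → Set
      Stabs p = ∀ x → Attached G M x → l x ≤ p × p ≤ r x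

      stabs? : Decidable Stabs
      stabs? p = Fin.all? λ x → attached? G M x →-dec ((l x ≤? p) ×-dec (p ≤? r x))

      clamp-stabs : ∀ {a b p} → Stabs p → (∀ x → Attached G M x → l x ≤ b × a ≤ r x) → Stabs (clamp a b p)
      clamp-stabs {p = p} stabs meets x attached =
        let lx≤b , a≤rx = meets x attached
            lx≤p , p≤rx = stabs x attached in
        clamp-stays-within p lx≤b a≤rx lx≤p p≤rx

      module _ (attached-adjacent : ∀ {x m} → Attached G M x → m ∈V M → x — m ∈ Ĝ) where

        attached-overlap : ∀ {x m} → Attached G M x → m ∈V M → l x ≤ r m × l m ≤ r x
        attached-overlap attached@(x∉M , _) m∈M =
          adjacent⇒overlap (λ { refl → x∉M m∈M }) (attached-adjacent attached m∈M)

        attachedVertices : List (Fin n)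
        attachedVertices = filter (attached? G M) (allFin n)

        -- Without attached vertices the defaults B and 0 still satisfy covers-α-β.
        α β : ℕ
        α = min B (map r attachedVertices)
        β = max 0 (map l attachedVertices)

        α≤r : ∀ {x} → Attached G M x → α ≤ r x
        α≤r {x} attached = All.lookup (min≤xs B (map r attachedVertices))
          (∈-map⁺ r (∈-filter⁺ (attached? G M) (∈-allFin x) attached))

        l≤β : ∀ {x} → Attached G M x → l x ≤ β
        l≤β {x} attached = All.lookup (xs≤max 0 (map l attachedVertices))
          (∈-map⁺ l (∈-filter⁺ (attached? G M) (∈-allFin x) attached))

        covers-α-β : ∀ m → m ∈V M → Covers m α β
        covers-α-β m m∈M =
            v≤min⁺ (l≤B m) (map⁺ (All.map (λ attached → proj₂ (attached-overlap attached m∈M)) all-attached))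
          , max≤v⁺ z≤n (map⁺ (All.map (λ attached → proj₁ (attached-overlap attached m∈M)) all-attached))
          where
          all-attached : All (Attached G M) attachedVertices
          all-attached = all-filter (attached? G M) (allFin n)

        module _ {u u′ v} (u∈M : u ∈V M) (u′∈M : u′ ∈V M) (u—u′ : u — u′ ∈ Ĝ)
                 (v∉M : ¬ v ∈V M) (v—u : v — u ∈ Ĝ) (v≁u′ : ¬ v — u′ ∈ Ĝ) where

          separating : ∀ {t₁ t₂} → Covers u t₁ t₂ → Covers u′ t₁ t₂ → windowCount t₁ t₂ < cutDegree M Ĝ u
          separating covers covers′ = windowCount-<-cutDegree u∈M covers v∉M (trans (Graph.sym Ĝ u v) v—u)
            (¬-not λ v-meets → v≁u′ (trans (Graph.sym Ĝ v u′)
              (covers-meets⇒adjacent covers′ (inside≢outside u′∈M (¬-not v∉M)) v-meets)))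

          point⇒smaller : ∀ {p₀} → Stabs p₀ → SmallerIntervalSupergraph G Ĝ
          point⇒smaller {p₀} stabs₀ =
            window⇒smaller ≤-refl (λ p<p → ⊥-elim (<-irrefl refl p<p)) p-stabs count≤ u∈M count<
            where
            count : ℕ → ℕ
            count p = windowCount p p

            candidates : List ℕ
            candidates = filter stabs? (upTo (suc B))

            p : ℕ
            p = argmin count p₀ candidates

            p-stabs : Stabs p
            p-stabs = argmin-all count stabs₀ (all-filter stabs? (upTo (suc B)))

            p-minimal : ∀ {q} → q ≤ B → Stabs q → count p ≤ count q
            p-minimal q≤B stabs-q =
              All.lookup (f[argmin]≤f[xs] p₀ candidates) (∈-filter⁺ stabs? (∈-upTo⁺ (s≤s q≤B)) stabs-q)

            p-minimal-within : ∀ {a b} → a ≤ b → b ≤ B → (∀ x → Attached G M x → l x ≤ b × a ≤ r x) →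
                               ∃ λ q → a ≤ q × q ≤ b × count p ≤ count q
            p-minimal-within {a} {b} a≤b b≤B meets =
              let a≤q , q≤b = clamp-between p a≤b in
              clamp a b p , a≤q , q≤b , p-minimal (≤-trans q≤b b≤B) (clamp-stabs p-stabs meets)

            count≤ : ∀ m → m ∈V M → count p ≤ cutDegree M Ĝ m
            count≤ m m∈M =
              let q , lm≤q , q≤rm , p≤q = p-minimal-within (l≤r m) (r≤B m) λ x attached → attached-overlap attached m∈M in
              ≤-trans p≤q (windowCount-≤-cutDegree m∈M (lm≤q , q≤rm))

            u≢u′ : u ≢ u′
            u≢u′ refl with () ← trans (sym u—u′) (Graph.irrefl Ĝ u)

            count< : count p < cutDegree M Ĝ u
            count< =
              let lu≤ru′ , lu′≤ru = adjacent⇒overlap u≢u′ u—u′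
                  q , a≤q , q≤b , p≤q =
                    p-minimal-within (⊔-lub (⊓-glb (l≤r u) lu≤ru′) (⊓-glb lu′≤ru (l≤r u′)))
                                     (≤-trans (m⊓n≤m (r u) (r u′)) (r≤B u))
                                     λ x attached →
                                       let lx≤ru , lu≤rx = attached-overlap attached u∈M
                                           lx≤ru′ , lu′≤rx = attached-overlap attached u′∈M in
                                       ⊓-glb lx≤ru lx≤ru′ , ⊔-lub lu≤rx lu′≤rx in
              ≤-<-trans p≤q (separating (≤-trans (m≤m⊔n (l u) (l u′)) a≤q , ≤-trans q≤b (m⊓n≤m (r u) (r u′)))
                                        (≤-trans (m≤n⊔m (l u) (l u′)) a≤q , ≤-trans q≤b (m⊓n≤n (r u) (r u′))))

          smaller : SmallerIntervalSupergraph G Ĝ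
          smaller with β ≤? α
          ... | yes β≤α = point⇒smaller λ x attached → l≤β attached , ≤-trans β≤α (α≤r attached)
          ... | no  β≰α = window⇒smaller (<⇒≤ (≰⇒> β≰α)) (λ _ → covers-α-β)
            (λ x attached → l≤β attached , α≤r attached)
            (λ m m∈M → windowCount-≤-cutDegree m∈M (covers-α-β m m∈M))
            u∈M (separating (covers-α-β u u∈M) (covers-α-β u′ u′∈M))

WalkIn-start : ∀ {n} {G : Graph n} {M a b} → WalkIn G M a b → a ∈V M
WalkIn-start (here a∈M)     = a∈M
WalkIn-start (step a∈M _ _) = a∈M

WalkIn-transport : ∀ {n} {G : Graph n} {M} (P : Fin n → Set) →
  (∀ {x y} → x ∈V M → y ∈V M → x — y ∈ G → P x → P y) →
  ∀ {a b} → WalkIn G M a b → P a → P b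
WalkIn-transport P along (here _)            Pa = Pa
WalkIn-transport P along (step a∈M a—c walk) Pa =
  WalkIn-transport P along walk (along a∈M (WalkIn-start walk) a—c Pa)

attached⇒complete : ∀ {n} (G G′ Ĝ : Graph n) (M : VSet n) → G ⊆E G′ → G′ ⊆E Ĝ → IsModule G′ M →
  ∀ {x m} → Attached G M x → m ∈V M → x — m ∈ Ĝ
attached⇒complete G G′ Ĝ M G⊆G′ G′⊆Ĝ module′ (x∉M , m₀ , m₀∈M , x—m₀) m∈M with module′ _ x∉M
... | inj₁ complete     = G′⊆Ĝ _ _ (complete _ m∈M)
... | inj₂ anticomplete = ⊥-elim (anticomplete m₀ m₀∈M (G⊆G′ _ _ x—m₀))

outer-neighbour-transfer : ∀ {n} (G Ĝ G′ : Graph n) → IsMinimumIntervalSupergraph G Ĝ → G ⊆E G′ → G′ ⊆E Ĝ →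
  ∀ M → IsModule G′ M → ∀ {u u′} v → u ∈V M → u′ ∈V M → u — u′ ∈ G′ →
  ¬ v ∈V M → v — u ∈ Ĝ → v — u′ ∈ Ĝ
outer-neighbour-transfer G Ĝ G′ minimum@(((l , r , l≤r , model) , G⊆Ĝ) , _) G⊆G′ G′⊆Ĝ M module′
                         {u} {u′} v u∈M u′∈M u—u′ v∉M v—u
  with adj Ĝ v u′ Bool.≟ true
... | yes v—u′ = v—u′
... | no  v≁u′ = ⊥-elim (minimum⇒¬smaller {G = G} {Ĝ} minimum
  (IntervalModel.smaller Ĝ l r l≤r model M G G⊆Ĝ (attached⇒complete G G′ Ĝ M G⊆G′ G′⊆Ĝ module′)
                         u∈M u′∈M (G′⊆Ĝ u u′ u—u′) v∉M v—u v≁u′))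

corollary3p5 : ∀ {n : ℕ} (G Ĝ G' : Graph n) →
    IsMinimumIntervalSupergraph G Ĝ →
    G ⊆E G' → G' ⊆E Ĝ →
    ∀ (M : VSet n) → IsModule G' M → InducedConnected G' M → IsModule Ĝ M
corollary3p5 G Ĝ G′ minimum G⊆G′ G′⊆Ĝ M module′ (_ , walk) v v∉M
  with Fin.any? (λ m → (M m Bool.≟ true) ×-dec (adj Ĝ v m Bool.≟ true))
... | yes (m , m∈M , v—m) = inj₁ λ w w∈M →
  WalkIn-transport (λ x → v — x ∈ Ĝ)
    (λ x∈M y∈M x—y → outer-neighbour-transfer G Ĝ G′ minimum G⊆G′ G′⊆Ĝ M module′ v x∈M y∈M x—y v∉M)
    (walk m w m∈M w∈M) v—m
... | no ∄neighbour = inj₂ λ w w∈M v—w → ∄neighbour (w , w∈M , v—w)
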